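{- Let $G$ be a connected graph and let $H_1,\dots,H_r$ ($r\ge 1$) be subgraphs of $G$ such that for each $i=1,\dots,r$ at most one vertex of $H_i$ is contained in $\bigcup_{j\ne i}H_j$. Let $n=|G|$ and $n'=\sum_{i=1}^r|H_i|$. Then for every positive integer $y$, $$Q_G(y)\le y^{\,n-n'}\left(\frac{y}{y+1}\right)^{r-1}\prod_{i=1}^r Q_{H_i}(y).$$
   Context: All graphs are finite and simple; $|H|$ denotes the number of vertices of $H$. For a positive integer $x$, an $x$-colouring of a graph is a map $V\to\{1,\dots,x\}$ giving adjacent vertices different values; $P_H(x)$ is the number of $x$-colourings (the chromatic polynomial), and $Q_H(y)=P_H(y+1)$ is the shifted chromatic polynomial. -}

module Defs where

open import Data.Nat using (ℕ; zero; suc; _+_; _*_)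
open import Data.Bool using (Bool; true; false; T)
open import Data.Fin using (Fin; zero; suc)
open import Data.Fin.Properties using (all?; _≟_)
open import Data.List using (List; []; _∷_; map; concatMap; filter; length; allFin)
open import Data.Product using (Σ; ∃; _×_; _,_)
open import Data.Empty using (⊥)
open import Relation.Nullary using (¬_; Dec; yes; no)
open import Relation.Nullary.Decidable using (¬?; _→-dec_)
open import Relation.Binary.PropositionalEquality using (_≡_; _≢_)
open import Data.Bool.Properties using (T?)

record Graph (n : ℕ) : Set where
  field
    adj       : Fin n → Fin n → Bool
    adj-sym   : ∀ u v → adj u v ≡ adj v u
    adj-irrefl : ∀ u → adj u u ≡ false
open Graph public

data Reach {n : ℕ} (G : Graph n) : Fin n → Fin n → Set where
  here : ∀ {u} → Reach G u u
  step : ∀ {u v w} → T (adj G u v) → Reach G v w → Reach G u w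

Connected : ∀ {n} → Graph n → Set
Connected {n} G = ∀ (u v : Fin n) → Reach G u v

Proper : ∀ {n} → Graph n → (x : ℕ) → (Fin n → Fin x) → Set
Proper {n} G x c = ∀ (u v : Fin n) → T (adj G u v) → c u ≢ c v

proper? : ∀ {n} (G : Graph n) (x : ℕ) (c : Fin n → Fin x) → Dec (Proper G x c)
proper? G x c = all? λ u → all? λ v → T? (adj G u v) →-dec ¬? (c u ≟ c v)

cons : ∀ {n x} → Fin x → (Fin n → Fin x) → Fin (suc n) → Fin x
cons a f zero = a
cons a f (suc i) = f i

allMaps : (n x : ℕ) → List (Fin n → Fin x)
allMaps zero x = (λ ()) ∷ []
allMaps (suc n) x = concatMap (λ a → map (cons a) (allMaps n x)) (allFin x)

P : ∀ {n} → Graph n → ℕ → ℕ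
P {n} G x = length (filter (proper? G x) (allMaps n x))

Q : ∀ {n} → Graph n → ℕ → ℕ
Q G y = P G (suc y)

record Subgraph {n : ℕ} (G : Graph n) : Set where
  field
    size    : ℕ
    graph   : Graph size
    emb     : Fin size → Fin n
    emb-inj : ∀ u v → emb u ≡ emb v → u ≡ v
    emb-adj : ∀ u v → T (adj graph u v) → T (adj G (emb u) (emb v))
open Subgraph public

sumFin : (r : ℕ) → (Fin r → ℕ) → ℕ
sumFin zero f = 0
sumFin (suc r) f = f zero + sumFin r (λ i → f (suc i))

prodFin : (r : ℕ) → (Fin r → ℕ) → ℕ
prodFin zero f = 1
prodFin (suc r) f = f zero * prodFin r (λ i → f (suc i))

InOthers : ∀ {n} {G : Graph n} {r : ℕ} → (Fin r → Subgraph G) → Fin r → Fin n → Set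
InOthers {r = r} H i w = Σ (Fin r) λ j → j ≢ i × Σ (Fin (size (H j))) λ t → emb (H j) t ≡ w

AtMostOneShared : ∀ {n} {G : Graph n} {r : ℕ} → (Fin r → Subgraph G) → Set
AtMostOneShared {r = r} H =
  ∀ (i : Fin r) (u v : Fin (size (H i))) →
    InOthers H i (emb (H i) u) → InOthers H i (emb (H i) v) → u ≡ v

-- Colour the vertices uniformly at random with x = y + 1 colours, so that
-- Q_G(y) = x^n · Pr[c is proper]. Starting from one piece, grow a cluster: either add
-- a piece H_i meeting the cluster (by hypothesis in exactly one vertex, since the
-- cluster's vertices in H_i lie in other pieces), or cross an edge uw leaving the
-- cluster and add w together with its piece, if any. Each step multiplies the
-- probability of the cluster's event (proper on the absorbed pieces and crossed edges)
-- by Q_{H_i}(y) / x^|H_i| or y / x or both, because two colour-symmetric events that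
-- share at most one vertex are independent. Connectivity lets this continue until the
-- cluster covers G and contains all r pieces; counting vertices shows that n + r − 1 − n'
-- edges were crossed, and comparing with Pr[c is proper] gives the bound.

module Submission where

open import Defs
open import Algebra.Bundles using (CommutativeMonoid)
open import Data.Bool.Base using (true; false; T)
open import Data.Empty using (⊥; ⊥-elim)
open import Data.Fin.Base using (Fin; zero; suc; punchIn; punchOut; fromℕ<)
import Data.Fin.Properties as Fin
open import Data.Fin.Properties using (_≟_; any?; punchOut-injective; punchIn-punchOut; punchInᵢ≢i)
open import Data.Fin.Permutation as Perm using (Permutation; _⟨$⟩ʳ_; _⟨$⟩ˡ_)
open import Data.Fin.Subset
  using (Subset; inside; outside; _∈_; _∉_; _⊆_; _∪_; _∩_; ⁅_⁆; ∣_∣; Empty; Nonempty)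
  renaming (⊤ to Full; ⊥ to ∅)
open import Data.Fin.Subset.Properties
  using (_∈?_; nonempty?; ∈⊤; ∉⊥; ∣⊤∣≡n; ∣⊥∣≡0; ∣⁅x⁆∣≡1; ∣p∣≤n; Empty-unique; ⊆-antisym;
         x∈⁅x⁆; x≢y⇒x∉⁅y⁆; x∈⁅y⁆⇒x≡y; x∈p∪q⁺; x∈p∪q⁻; x∈p∩q⁺; x∈p∩q⁻; p⊆p∪q; q⊆p∪q; ∪-identityˡ)
open import Data.List.Base using (List; []; _∷_; _++_; length; filter; map; concatMap; tabulate; allFin)
open import Data.List.Properties using (filter-++; length-++)
open import Data.Nat.Base using (ℕ; zero; suc; _+_; _*_; _^_; _∸_; _≤_; _<_; z≤n; z<s)
open import Data.Nat.Induction using (<-wellFounded)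
open import Data.Nat.Properties
  using (+-suc; +-identityʳ; +-comm; *-comm; *-assoc; *-identityʳ; +-mono-≤; ≤-reflexive; ≤-trans;
         *-cancelʳ-≡; *-cancelʳ-≤; *-monoˡ-≤; m^n≢0; ^-distribˡ-+-*; suc-injective; m<m+n; m≤m+n;
         ∸-monoʳ-<; <⇒≤; +-∸-assoc; +-0-commutativeMonoid; *-1-commutativeMonoid; +-*-semiring)
open import Data.Nat.Tactic.RingSolver using (solve-∀)
open import Data.Product using (Σ; Σ-syntax; ∃; _×_; _,_; proj₁; proj₂)
open import Data.Sum using (_⊎_; inj₁; inj₂)
open import Data.Unit.Base using (⊤; tt)
open import Data.Vec.Base using ([]; _∷_; here; there)
open import Data.Vec.Functional using (Vector; insertAt)
open import Data.Vec.Functional.Properties using (insertAt-lookup; insertAt-punchIn)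
open import Function.Base using (_∘_; case_of_)
open import Function.Definitions using (Injective)
open import Induction.WellFounded using (Acc; acc)
open import Relation.Binary.PropositionalEquality
open import Relation.Nullary using (¬_; ¬?; Dec; yes; no; does)
open import Relation.Nullary.Decidable using (_×-dec_; decidable-stable)
open import Relation.Unary using (Decidable)

open import Algebra.Properties.Semiring.Sum +-*-semiring
  using (sum; sum-syntax; sum-cong-≗; sum-permute; sum-remove; ∑-comm; *-distribˡ-sum; *-distribʳ-sum)

open ≡-Reasoning

sum-const : ∀ {n} {f : Vector ℕ n} k → (∀ i → f i ≡ k) → sum f ≡ n * k
sum-const {zero}  k f≡k = refl
sum-const {suc n} k f≡k = cong₂ _+_ (f≡k zero) (sum-const k (f≡k ∘ suc))

∑-*-constˡ : ∀ {n} (f g : Vector ℕ n) → (∀ i j → f i ≡ f j) →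
             sum (λ i → f i * g i) * n ≡ sum f * sum g
∑-*-constˡ {zero}  f g const = refl
∑-*-constˡ {suc n} f g const = begin
  sum (λ i → f i * g i) * suc n     ≡⟨ cong (_* suc n) (sum-cong-≗ (λ i → cong (_* g i) (const i zero))) ⟩
  sum (λ i → f zero * g i) * suc n  ≡⟨ cong (_* suc n) (*-distribˡ-sum (f zero) g) ⟨
  f zero * sum g * suc n            ≡⟨ rotate (f zero) (sum g) (suc n) ⟩
  suc n * f zero * sum g            ≡⟨ cong (_* sum g) (sum-const (f zero) (λ i → const i zero)) ⟨
  sum f * sum g                     ∎
  where
  rotate : ∀ a b c → a * b * c ≡ c * a * b
  rotate = solve-∀

sum-mono-≤ : ∀ {n} {f g : Vector ℕ n} → (∀ i → f i ≤ g i) → sum f ≤ sum g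
sum-mono-≤ {zero}  f≤g = z≤n
sum-mono-≤ {suc n} f≤g = +-mono-≤ (f≤g zero) (sum-mono-≤ (f≤g ∘ suc))

∑-slices : ∀ {n} (h f g : Vector ℕ n) k → (∀ i j → f i ≡ f j) →
           (∀ i → h i * k ≡ f i * g i) → sum h * (n * k) ≡ sum f * sum g
∑-slices {n} h f g k const h≡fg = begin
  sum h * (n * k)               ≡⟨ swap (sum h) n k ⟩
  sum h * k * n                 ≡⟨ cong (_* n) (*-distribʳ-sum k h) ⟩
  sum (λ i → h i * k) * n       ≡⟨ cong (_* n) (sum-cong-≗ h≡fg) ⟩
  sum (λ i → f i * g i) * n     ≡⟨ ∑-*-constˡ f g const ⟩
  sum f * sum g                 ∎
  where
  swap : ∀ a b c → a * (b * c) ≡ a * c * b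
  swap = solve-∀

⟦_⟧ : ∀ {P : Set} → Dec P → ℕ
⟦ yes _ ⟧ = 1
⟦ no  _ ⟧ = 0

⟦⟧-yes : ∀ {P : Set} (P? : Dec P) → P → ⟦ P? ⟧ ≡ 1
⟦⟧-yes (yes _) _ = refl
⟦⟧-yes (no ¬p) p = ⊥-elim (¬p p)

⟦⟧-no : ∀ {P : Set} (P? : Dec P) → ¬ P → ⟦ P? ⟧ ≡ 0
⟦⟧-no (yes p) ¬p = ⊥-elim (¬p p)
⟦⟧-no (no _)  _  = refl

⟦⟧-cong : ∀ {P Q : Set} (P? : Dec P) (Q? : Dec Q) → (P → Q) → (Q → P) → ⟦ P? ⟧ ≡ ⟦ Q? ⟧
⟦⟧-cong (yes _) (yes _) _   _   = refl
⟦⟧-cong (no _)  (no _)  _   _   = refl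
⟦⟧-cong (yes p) (no ¬q) p→q _   = ⊥-elim (¬q (p→q p))
⟦⟧-cong (no ¬p) (yes q) _   q→p = ⊥-elim (¬p (q→p q))

⟦⟧-≤ : ∀ {P : Set} (P? : Dec P) {k} → (P → k ≡ 1) → ⟦ P? ⟧ ≤ k
⟦⟧-≤ (yes p) k≡1 = ≤-reflexive (sym (k≡1 p))
⟦⟧-≤ (no _)  _   = z≤n

module _ {A : Set} {P : A → Set} (P? : Decidable P) where

  length-filter-[-] : ∀ a → length (filter P? (a ∷ [])) ≡ ⟦ P? a ⟧
  length-filter-[-] a with P? a
  ... | yes _ = refl
  ... | no  _ = refl

  length-filter-++ : ∀ xs ys → length (filter P? (xs ++ ys)) ≡ length (filter P? xs) + length (filter P? ys)
  length-filter-++ xs ys = trans (cong length (filter-++ P? xs ys)) (length-++ (filter P? xs))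

  length-filter-concatMap : ∀ {B : Set} {n} (h : B → List A) (g : Fin n → B) →
    length (filter P? (concatMap h (tabulate g))) ≡ ∑[ i < n ] length (filter P? (h (g i)))
  length-filter-concatMap {n = zero}  h g = refl
  length-filter-concatMap {n = suc n} h g =
    trans (length-filter-++ (h (g zero)) _) (cong (_ +_) (length-filter-concatMap h (g ∘ suc)))

length-filter-map : ∀ {A B : Set} {P : B → Set} (P? : Decidable P) (f : A → B) xs →
                    length (filter P? (map f xs)) ≡ length (filter (P? ∘ f) xs)
length-filter-map P? f []       = refl
length-filter-map P? f (a ∷ xs) with does (P? (f a))
... | true  = cong suc (length-filter-map P? f xs)
... | false = length-filter-map P? f xs

transpose-maps : ∀ {n} (a b : Fin n) → Perm.transpose a b ⟨$⟩ʳ a ≡ b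
transpose-maps a b with a ≟ a
... | yes _   = refl
... | no a≢a = ⊥-elim (a≢a refl)

cons-cong : ∀ {n k} (a : Fin k) {c d : Fin n → Fin k} → c ≗ d → cons a c ≗ cons a d
cons-cong a c≗d zero    = refl
cons-cong a c≗d (suc i) = c≗d i

cons-map : ∀ {n k l} (f : Fin k → Fin l) a (c : Fin n → Fin k) → f ∘ cons a c ≗ cons (f a) (f ∘ c)
cons-map f a c zero    = refl
cons-map f a c (suc i) = refl

cons≗insertAt : ∀ {n k} (a : Fin k) (c : Fin n → Fin k) → cons a c ≗ insertAt c zero a
cons≗insertAt a c zero    = refl
cons≗insertAt a c (suc i) = refl

cons-insertAt : ∀ {n k} (c : Fin n → Fin k) v a b →
                cons b (insertAt c v a) ≗ insertAt (cons b c) (suc v) a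
cons-insertAt c v a b zero    = refl
cons-insertAt c v a b (suc j) = refl

insertAt-map : ∀ {A B : Set} {n} (f : A → B) (c : Fin n → A) v a →
               f ∘ insertAt c v a ≗ insertAt (f ∘ c) v (f a)
insertAt-map         f c zero    a zero    = refl
insertAt-map         f c zero    a (suc j) = refl
insertAt-map {n = suc n} f c (suc v) a zero    = refl
insertAt-map {n = suc n} f c (suc v) a (suc j) = insertAt-map f (c ∘ suc) v a j

insertAt-agree : ∀ {A : Set} {n} {P : Fin (suc n) → Set} {c d : Fin n → A} v a →
                 (∀ {i} → P (punchIn v i) → c i ≡ d i) →
                 ∀ {j} → P j → insertAt c v a j ≡ insertAt d v a j
insertAt-agree             zero    a agree {zero}  _  = refl
insertAt-agree             zero    a agree {suc j} Pj = agree Pj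
insertAt-agree {n = suc n} (suc v) a agree {zero}  Pj = agree Pj
insertAt-agree {n = suc n} (suc v) a agree {suc j} Pj = insertAt-agree v a agree Pj

insertAt-cong : ∀ {A : Set} {n} {c d : Fin n → A} v a → c ≗ d → insertAt c v a ≗ insertAt d v a
insertAt-cong v a c≗d j = insertAt-agree {P = λ _ → ⊤} v a (λ {i} _ → c≗d i) tt

module _ {m n} (e : Fin (suc m) → Fin (suc n)) (e-inj : Injective _≡_ _≡_ e) where

  private
    e0≢e : ∀ t → e zero ≢ e (suc t)
    e0≢e t e0≡et with e-inj e0≡et
    ... | ()

  punchOutTail : Fin m → Fin n
  punchOutTail t = punchOut (e0≢e t)

  punchOutTail-injective : Injective _≡_ _≡_ punchOutTail
  punchOutTail-injective e′s≡e′t = Fin.suc-injective (e-inj (punchOut-injective (e0≢e _) (e0≢e _) e′s≡e′t))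

  insertAt-∘-injection : ∀ {k} (c : Fin n → Fin k) a → insertAt c (e zero) a ∘ e ≗ cons a (c ∘ punchOutTail)
  insertAt-∘-injection c a zero    = insertAt-lookup c (e zero) a
  insertAt-∘-injection c a (suc t) = begin
    insertAt c (e zero) a (e (suc t))                        ≡⟨ cong (insertAt c (e zero) a) (punchIn-punchOut (e0≢e t)) ⟨
    insertAt c (e zero) a (punchIn (e zero) (punchOutTail t)) ≡⟨ insertAt-punchIn c (e zero) a (punchOutTail t) ⟩
    c (punchOutTail t)                                        ∎

permutation-injective : ∀ {n} (π : Permutation n n) {i j} → π ⟨$⟩ʳ i ≡ π ⟨$⟩ʳ j → i ≡ j
permutation-injective π {i} {j} πi≡πj = begin
  i                     ≡⟨ Perm.inverseˡ π ⟨
  π ⟨$⟩ˡ (π ⟨$⟩ʳ i)     ≡⟨ cong (π ⟨$⟩ˡ_) πi≡πj ⟩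
  π ⟨$⟩ˡ (π ⟨$⟩ʳ j)     ≡⟨ Perm.inverseˡ π ⟩
  j                     ∎

∣p∪q∣+∣p∩q∣≡∣p∣+∣q∣ : ∀ {n} (p q : Subset n) → ∣ p ∪ q ∣ + ∣ p ∩ q ∣ ≡ ∣ p ∣ + ∣ q ∣
∣p∪q∣+∣p∩q∣≡∣p∣+∣q∣ []            []            = refl
∣p∪q∣+∣p∩q∣≡∣p∣+∣q∣ (outside ∷ p) (outside ∷ q) = ∣p∪q∣+∣p∩q∣≡∣p∣+∣q∣ p q
∣p∪q∣+∣p∩q∣≡∣p∣+∣q∣ (outside ∷ p) (inside  ∷ q) = begin
  suc ∣ p ∪ q ∣ + ∣ p ∩ q ∣ ≡⟨ cong suc (∣p∪q∣+∣p∩q∣≡∣p∣+∣q∣ p q) ⟩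
  suc (∣ p ∣ + ∣ q ∣)       ≡⟨ +-suc ∣ p ∣ ∣ q ∣ ⟨
  ∣ p ∣ + suc ∣ q ∣         ∎
∣p∪q∣+∣p∩q∣≡∣p∣+∣q∣ (inside  ∷ p) (outside ∷ q) = cong suc (∣p∪q∣+∣p∩q∣≡∣p∣+∣q∣ p q)
∣p∪q∣+∣p∩q∣≡∣p∣+∣q∣ (inside  ∷ p) (inside  ∷ q) = begin
  suc (∣ p ∪ q ∣ + suc ∣ p ∩ q ∣) ≡⟨ cong suc (+-suc ∣ p ∪ q ∣ ∣ p ∩ q ∣) ⟩
  suc (suc (∣ p ∪ q ∣ + ∣ p ∩ q ∣)) ≡⟨ cong (2 +_) (∣p∪q∣+∣p∩q∣≡∣p∣+∣q∣ p q) ⟩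
  suc (suc (∣ p ∣ + ∣ q ∣))       ≡⟨ cong suc (+-suc ∣ p ∣ ∣ q ∣) ⟨
  suc (∣ p ∣ + suc ∣ q ∣)         ∎

∣⁅x⁆∪p∣≡1+∣p∣ : ∀ {n} {x : Fin n} {p} → x ∉ p → ∣ ⁅ x ⁆ ∪ p ∣ ≡ suc ∣ p ∣
∣⁅x⁆∪p∣≡1+∣p∣ {n} {x} {p} x∉p = begin
  ∣ ⁅ x ⁆ ∪ p ∣                     ≡⟨ +-identityʳ _ ⟨
  ∣ ⁅ x ⁆ ∪ p ∣ + 0                 ≡⟨ cong (∣ ⁅ x ⁆ ∪ p ∣ +_) (∣⊥∣≡0 n) ⟨
  ∣ ⁅ x ⁆ ∪ p ∣ + ∣ ∅ {n} ∣         ≡⟨ cong (λ q → ∣ ⁅ x ⁆ ∪ p ∣ + ∣ q ∣) (Empty-unique disjoint) ⟨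
  ∣ ⁅ x ⁆ ∪ p ∣ + ∣ ⁅ x ⁆ ∩ p ∣     ≡⟨ ∣p∪q∣+∣p∩q∣≡∣p∣+∣q∣ ⁅ x ⁆ p ⟩
  ∣ ⁅ x ⁆ ∣ + ∣ p ∣                 ≡⟨ cong (_+ ∣ p ∣) (∣⁅x⁆∣≡1 x) ⟩
  suc ∣ p ∣                         ∎
  where
  disjoint : Empty (⁅ x ⁆ ∩ p)
  disjoint (y , y∈) with x∈p∩q⁻ ⁅ x ⁆ p y∈
  ... | y∈⁅x⁆ , y∈p rewrite x∈⁅y⁆⇒x≡y x y∈⁅x⁆ = x∉p y∈p

∩≡⁅⁆ : ∀ {n} {p q : Subset n} {x} → x ∈ p → x ∈ q → (∀ {y} → y ∈ p → y ∈ q → y ≡ x) → p ∩ q ≡ ⁅ x ⁆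
∩≡⁅⁆ {p = p} {q} {x} x∈p x∈q only-x = ⊆-antisym
  (λ y∈p∩q → let y∈p , y∈q = x∈p∩q⁻ p q y∈p∩q in subst (_∈ ⁅ x ⁆) (sym (only-x y∈p y∈q)) (x∈⁅x⁆ x))
  (λ y∈⁅x⁆ → subst (_∈ p ∩ q) (sym (x∈⁅y⁆⇒x≡y x y∈⁅x⁆)) (x∈p∩q⁺ (x∈p , x∈q)))

x∈p⇒⁅x⁆⊆p : ∀ {n} {p : Subset n} {x} → x ∈ p → ⁅ x ⁆ ⊆ p
x∈p⇒⁅x⁆⊆p {x = x} x∈p y∈⁅x⁆ = subst (_∈ _) (sym (x∈⁅y⁆⇒x≡y x y∈⁅x⁆)) x∈p

∀∈⇒≡Full : ∀ {n} {p : Subset n} → (∀ x → x ∈ p) → p ≡ Full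
∀∈⇒≡Full ∀∈p = ⊆-antisym (λ _ → ∈⊤) (λ {x} _ → ∀∈p x)

∈-pair⁻ : ∀ {n} {x y z : Fin n} → z ∈ ⁅ x ⁆ ∪ ⁅ y ⁆ → z ≡ x ⊎ z ≡ y
∈-pair⁻ {x = x} {y} z∈ with x∈p∪q⁻ ⁅ x ⁆ ⁅ y ⁆ z∈
... | inj₁ z∈⁅x⁆ = inj₁ (x∈⁅y⁆⇒x≡y x z∈⁅x⁆)
... | inj₂ z∈⁅y⁆ = inj₂ (x∈⁅y⁆⇒x≡y y z∈⁅y⁆)

∣p∪q∣+1≡∣p∣+∣q∣ : ∀ {n} {p q : Subset n} {v} → p ∩ q ≡ ⁅ v ⁆ → ∣ p ∪ q ∣ + 1 ≡ ∣ p ∣ + ∣ q ∣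
∣p∪q∣+1≡∣p∣+∣q∣ {p = p} {q} {v} meet = begin
  ∣ p ∪ q ∣ + 1         ≡⟨ cong (∣ p ∪ q ∣ +_) (∣⁅x⁆∣≡1 v) ⟨
  ∣ p ∪ q ∣ + ∣ ⁅ v ⁆ ∣ ≡⟨ cong (λ s → ∣ p ∪ q ∣ + ∣ s ∣) meet ⟨
  ∣ p ∪ q ∣ + ∣ p ∩ q ∣ ≡⟨ ∣p∪q∣+∣p∩q∣≡∣p∣+∣q∣ p q ⟩
  ∣ p ∣ + ∣ q ∣         ∎

∩⁅x⁆∪⁅y⁆≡⁅x⁆ : ∀ {n} {p : Subset n} {x y} → x ∈ p → y ∉ p → p ∩ (⁅ x ⁆ ∪ ⁅ y ⁆) ≡ ⁅ x ⁆
∩⁅x⁆∪⁅y⁆≡⁅x⁆ {x = x} x∈p y∉p = ∩≡⁅⁆ x∈p (x∈p∪q⁺ (inj₁ (x∈⁅x⁆ x))) λ z∈p z∈xy → case ∈-pair⁻ z∈xy of λ where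
  (inj₁ z≡x)  → z≡x
  (inj₂ refl) → ⊥-elim (y∉p z∈p)

image : ∀ {m n} → (Fin m → Fin n) → Subset n
image {zero}  e = ∅
image {suc m} e = ⁅ e zero ⁆ ∪ image (e ∘ suc)

∈-image⁺ : ∀ {m n} (e : Fin m → Fin n) t → e t ∈ image e
∈-image⁺ e zero    = x∈p∪q⁺ (inj₁ (x∈⁅x⁆ (e zero)))
∈-image⁺ e (suc t) = x∈p∪q⁺ (inj₂ (∈-image⁺ (e ∘ suc) t))

∈-image⁻ : ∀ {m n} (e : Fin m → Fin n) {v} → v ∈ image e → ∃ λ t → e t ≡ v
∈-image⁻ {zero}  e v∈ = ⊥-elim (∉⊥ v∈)
∈-image⁻ {suc m} e v∈ with x∈p∪q⁻ ⁅ e zero ⁆ (image (e ∘ suc)) v∈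
... | inj₁ v∈⁅e0⁆ = zero , sym (x∈⁅y⁆⇒x≡y (e zero) v∈⁅e0⁆)
... | inj₂ v∈rest with ∈-image⁻ (e ∘ suc) v∈rest
...   | t , et≡v = suc t , et≡v

∣image∣≡m : ∀ {m n} (e : Fin m → Fin n) → Injective _≡_ _≡_ e → ∣ image e ∣ ≡ m
∣image∣≡m {zero} {n} e inj = ∣⊥∣≡0 n
∣image∣≡m {suc m} e inj = begin
  ∣ ⁅ e zero ⁆ ∪ image (e ∘ suc) ∣ ≡⟨ ∣⁅x⁆∪p∣≡1+∣p∣ fresh ⟩
  suc ∣ image (e ∘ suc) ∣          ≡⟨ cong suc (∣image∣≡m (e ∘ suc) (Fin.suc-injective ∘ inj)) ⟩
  suc m                            ∎
  where
  fresh : e zero ∉ image (e ∘ suc)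
  fresh e0∈ with ∈-image⁻ (e ∘ suc) e0∈
  ... | t , et≡e0 with inj et≡e0
  ... | ()

module SubsetFold {c ℓ} (M : CommutativeMonoid c ℓ) where

  open CommutativeMonoid M
    using (Carrier; _≈_; _∙_; ε; ∙-congˡ; identityʳ; commutativeSemigroup)
    renaming (refl to ≈-refl; trans to ≈-trans)
  open import Algebra.Properties.CommutativeSemigroup commutativeSemigroup using (x∙yz≈y∙xz)

  fold : ∀ {n} → Subset n → (Fin n → Carrier) → Carrier
  fold []            f = ε
  fold (inside  ∷ p) f = f zero ∙ fold p (f ∘ suc)
  fold (outside ∷ p) f = fold p (f ∘ suc)

  fold-∅ : ∀ {n} (f : Fin n → Carrier) → fold ∅ f ≈ ε
  fold-∅ {zero}  f = ≈-refl
  fold-∅ {suc n} f = fold-∅ (f ∘ suc)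

  fold-⁅⁆∪ : ∀ {n} {x : Fin n} {p} (f : Fin n → Carrier) → x ∉ p → fold (⁅ x ⁆ ∪ p) f ≈ f x ∙ fold p f
  fold-⁅⁆∪ {x = zero}  {outside ∷ p} f x∉p rewrite ∪-identityˡ p = ≈-refl
  fold-⁅⁆∪ {x = zero}  {inside  ∷ p} f x∉p = ⊥-elim (x∉p here)
  fold-⁅⁆∪ {x = suc x} {outside ∷ p} f x∉p = fold-⁅⁆∪ (f ∘ suc) (x∉p ∘ there)
  fold-⁅⁆∪ {x = suc x} {inside  ∷ p} f x∉p =
    ≈-trans (∙-congˡ (fold-⁅⁆∪ (f ∘ suc) (x∉p ∘ there))) (x∙yz≈y∙xz _ _ _)

  fold-⁅⁆ : ∀ {n} (x : Fin n) (f : Fin n → Carrier) → fold ⁅ x ⁆ f ≈ f x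
  fold-⁅⁆ zero    f = ≈-trans (∙-congˡ (fold-∅ (f ∘ suc))) (identityʳ (f zero))
  fold-⁅⁆ (suc x) f = fold-⁅⁆ x (f ∘ suc)

module Sum     = SubsetFold +-0-commutativeMonoid
module Product = SubsetFold *-1-commutativeMonoid

sumFin≡fold : ∀ r (f : Fin r → ℕ) → sumFin r f ≡ Sum.fold Full f
sumFin≡fold zero    f = refl
sumFin≡fold (suc r) f = cong (f zero +_) (sumFin≡fold r (f ∘ suc))

prodFin≡fold : ∀ r (f : Fin r → ℕ) → prodFin r f ≡ Product.fold Full f
prodFin≡fold zero    f = refl
prodFin≡fold (suc r) f = cong (f zero *_) (prodFin≡fold r (f ∘ suc))

-- Uniformly random colourings

module Colourings (x : ℕ) where

  Colouring : ℕ → Set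
  Colouring n = Fin n → Fin x

  Extensional : ∀ {n} → (Colouring n → ℕ) → Set
  Extensional F = ∀ {c d} → c ≗ d → F c ≡ F d

  DependsOn : ∀ {n} → (Fin n → Set) → (Colouring n → ℕ) → Set
  DependsOn P F = ∀ {c d} → (∀ {i} → P i → c i ≡ d i) → F c ≡ F d

  ColourSymmetric : ∀ {n} → (Colouring n → ℕ) → Set
  ColourSymmetric F = ∀ (π : Permutation x x) c → F ((π ⟨$⟩ʳ_) ∘ c) ≡ F c

  total : ∀ n → (Colouring n → ℕ) → ℕ
  total zero    F = F (λ ())
  total (suc n) F = ∑[ a < x ] total n (F ∘ cons a)

  depends⇒extensional : ∀ {n P} {F : Colouring n → ℕ} → DependsOn P F → Extensional F
  depends⇒extensional F-dep c≗d = F-dep (λ {i} _ → c≗d i)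

  total-cong : ∀ {n} {F G : Colouring n → ℕ} → (∀ c → F c ≡ G c) → total n F ≡ total n G
  total-cong {zero}  F≡G = F≡G _
  total-cong {suc n} F≡G = sum-cong-≗ (λ a → total-cong (F≡G ∘ cons a))

  total-mono-≤ : ∀ {n} {F G : Colouring n → ℕ} → (∀ c → F c ≤ G c) → total n F ≤ total n G
  total-mono-≤ {zero}  F≤G = F≤G _
  total-mono-≤ {suc n} F≤G = sum-mono-≤ (λ a → total-mono-≤ (F≤G ∘ cons a))

  total-const : ∀ {n} {F : Colouring n → ℕ} k → (∀ c → F c ≡ k) → total n F ≡ x ^ n * k
  total-const {zero}  k F≡k = trans (F≡k _) (sym (+-identityʳ k))
  total-const {suc n} {F} k F≡k = begin
    ∑[ a < x ] total n (F ∘ cons a) ≡⟨ sum-const (x ^ n * k) (λ a → total-const k (F≡k ∘ cons a)) ⟩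
    x * (x ^ n * k)                 ≡⟨ *-assoc x (x ^ n) k ⟨
    x * x ^ n * k                   ∎

  total-insertAt : ∀ {m} {F : Colouring (suc m) → ℕ} → Extensional F → (v : Fin (suc m)) →
                   total (suc m) F ≡ ∑[ a < x ] total m (λ c → F (insertAt c v a))
  total-insertAt F-ext zero = sum-cong-≗ (λ a → total-cong (λ c → F-ext (cons≗insertAt a c)))
  total-insertAt {suc m} {F} F-ext (suc v) = begin
    ∑[ b < x ] total (suc m) (F ∘ cons b)
      ≡⟨ sum-cong-≗ (λ b → total-insertAt (F-ext ∘ cons-cong b) v) ⟩
    ∑[ b < x ] ∑[ a < x ] total m (λ c → F (cons b (insertAt c v a)))
      ≡⟨ ∑-comm (λ b a → total m (λ c → F (cons b (insertAt c v a)))) ⟩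
    ∑[ a < x ] ∑[ b < x ] total m (λ c → F (cons b (insertAt c v a)))
      ≡⟨ sum-cong-≗ (λ a → sum-cong-≗ (λ b → total-cong (λ c → F-ext (cons-insertAt c v a b)))) ⟩
    ∑[ a < x ] total (suc m) (λ c → F (insertAt c (suc v) a)) ∎

  total-permute : ∀ {n} {F : Colouring n → ℕ} → Extensional F → (π : Permutation x x) →
                  total n (λ c → F ((π ⟨$⟩ʳ_) ∘ c)) ≡ total n F
  total-permute {zero}      F-ext π = F-ext (λ ())
  total-permute {suc n} {F} F-ext π = begin
    ∑[ a < x ] total n (λ c → F ((π ⟨$⟩ʳ_) ∘ cons a c))
      ≡⟨ sum-cong-≗ (λ a → total-cong (λ c → F-ext (cons-map (π ⟨$⟩ʳ_) a c))) ⟩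
    ∑[ a < x ] total n (λ c → F (cons (π ⟨$⟩ʳ a) ((π ⟨$⟩ʳ_) ∘ c)))
      ≡⟨ sum-cong-≗ (λ a → total-permute (F-ext ∘ cons-cong (π ⟨$⟩ʳ a)) π) ⟩
    ∑[ a < x ] total n (F ∘ cons (π ⟨$⟩ʳ a))
      ≡⟨ sum-permute (λ b → total n (F ∘ cons b)) π ⟨
    ∑[ b < x ] total n (F ∘ cons b) ∎

  total-emb : ∀ {m n} {F : Colouring m → ℕ} → Extensional F → (e : Fin m → Fin n) →
              Injective _≡_ _≡_ e → total n (λ c → F (c ∘ e)) * x ^ m ≡ x ^ n * total m F
  total-emb {zero} {n} {F} F-ext e e-inj = begin
    total n (λ c → F (c ∘ e)) * 1 ≡⟨ *-identityʳ _ ⟩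
    total n (λ c → F (c ∘ e))     ≡⟨ total-const {n} (total zero F) (λ c → F-ext (λ ())) ⟩
    x ^ n * total zero F          ∎
  total-emb {suc m} {zero} F-ext e e-inj with e zero
  ... | ()
  total-emb {suc m} {suc n} {F} F-ext e e-inj = begin
    total (suc n) (λ c → F (c ∘ e)) * (x * x ^ m)
      ≡⟨ cong (_* (x * x ^ m)) (total-insertAt (λ c≗d → F-ext (c≗d ∘ e)) (e zero)) ⟩
    ∑[ a < x ] total n (λ c → F (insertAt c (e zero) a ∘ e)) * (x * x ^ m)
      ≡⟨ cong (_* (x * x ^ m)) (sum-cong-≗ (λ a → total-cong (λ c → F-ext (insertAt-∘-injection e e-inj c a)))) ⟩
    ∑[ a < x ] total n (λ c → F (cons a (c ∘ e′))) * (x * x ^ m)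
      ≡⟨ rearrange (∑[ a < x ] total n (λ c → F (cons a (c ∘ e′)))) x (x ^ m) ⟩
    x * (∑[ a < x ] total n (λ c → F (cons a (c ∘ e′))) * x ^ m)
      ≡⟨ cong (x *_) (*-distribʳ-sum (x ^ m) (λ a → total n (λ c → F (cons a (c ∘ e′))))) ⟩
    x * ∑[ a < x ] (total n (λ c → F (cons a (c ∘ e′))) * x ^ m)
      ≡⟨ cong (x *_) (sum-cong-≗ (λ a → total-emb (F-ext ∘ cons-cong a) e′ (punchOutTail-injective e e-inj))) ⟩
    x * ∑[ a < x ] (x ^ n * total m (F ∘ cons a))
      ≡⟨ cong (x *_) (*-distribˡ-sum (x ^ n) (λ a → total m (F ∘ cons a))) ⟨
    x * (x ^ n * total (suc m) F)
      ≡⟨ *-assoc x (x ^ n) _ ⟨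
    x * x ^ n * total (suc m) F ∎
    where
    e′ = punchOutTail e e-inj
    rearrange : ∀ a b c → a * (b * c) ≡ b * (a * c)
    rearrange = solve-∀

  total-slice-invariant : ∀ {m} {F : Colouring (suc m) → ℕ} → Extensional F → ColourSymmetric F →
    (v : Fin (suc m)) (a b : Fin x) →
    total m (λ c → F (insertAt c v a)) ≡ total m (λ c → F (insertAt c v b))
  total-slice-invariant {m} {F} F-ext F-sym v a b = begin
    total m (λ c → F (insertAt c v a))
      ≡⟨ total-cong (λ c → F-sym π (insertAt c v a)) ⟨
    total m (λ c → F ((π ⟨$⟩ʳ_) ∘ insertAt c v a))
      ≡⟨ total-cong (λ c → F-ext (λ j → trans (insertAt-map (π ⟨$⟩ʳ_) c v a j)
                                             (cong (λ z → insertAt ((π ⟨$⟩ʳ_) ∘ c) v z j) (transpose-maps a b)))) ⟩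
    total m (λ c → F (insertAt ((π ⟨$⟩ʳ_) ∘ c) v b))
      ≡⟨ total-permute (λ c≗d → F-ext (insertAt-cong v b c≗d)) π ⟩
    total m (λ c → F (insertAt c v b)) ∎
    where π = Perm.transpose a b

  cons-depends : ∀ {n P} {F : Colouring (suc n) → ℕ} a → DependsOn P F → DependsOn (P ∘ suc) (F ∘ cons a)
  cons-depends a F-dep agree = F-dep λ { {zero} _ → refl ; {suc i} Pi → agree Pi }

  cons-invariant : ∀ {n P} {F : Colouring (suc n) → ℕ} → DependsOn P F → ¬ P zero →
                   ∀ a b → total n (F ∘ cons a) ≡ total n (F ∘ cons b)
  cons-invariant {n} F-dep ¬P0 a b = total-cong {n} (λ c → F-dep {cons a c} {cons b c} λ { {zero} P0 → ⊥-elim (¬P0 P0) ; {suc i} _ → refl })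

  total-*-disjoint : ∀ {n} {P Q : Fin n → Set} {F G : Colouring n → ℕ} → Decidable P →
    DependsOn P F → DependsOn Q G → (∀ {i} → P i → Q i → ⊥) →
    total n (λ c → F c * G c) * x ^ n ≡ total n F * total n G
  total-*-disjoint {zero} P? F-dep G-dep disjoint = *-identityʳ _
  total-*-disjoint {suc n} {P} {Q} {F} {G} P? F-dep G-dep disjoint = case P? zero of λ where
      (no ¬P0) → ∑-slices tFG tF tG (x ^ n) (cons-invariant F-dep ¬P0) slice
      (yes P0) → trans (∑-slices tFG tG tF (x ^ n) (cons-invariant G-dep (disjoint P0))
                                 (λ a → trans (slice a) (*-comm (tF a) (tG a))))
                       (*-comm (sum tG) (sum tF))
    where
    tF tG tFG : Fin x → ℕ
    tF a = total n (F ∘ cons a)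
    tG a = total n (G ∘ cons a)
    tFG a = total n (λ c → F (cons a c) * G (cons a c))
    slice : ∀ a → tFG a * x ^ n ≡ tF a * tG a
    slice a = total-*-disjoint (P? ∘ suc) (cons-depends a F-dep) (cons-depends a G-dep) disjoint

  insertAt-depends : ∀ {m P} {F : Colouring (suc m) → ℕ} v a →
                     DependsOn P F → DependsOn (P ∘ punchIn v) (λ c → F (insertAt c v a))
  insertAt-depends v a F-dep agree = F-dep (insertAt-agree v a agree)

  -- Fixing the colour of the shared vertex v makes F and G independent, and by colour
  -- symmetry the conditional totals do not depend on which colour v gets.
  total-*-shared : ∀ {n} {P Q : Fin n → Set} {F G : Colouring n → ℕ} (v : Fin n) → Decidable P →
    DependsOn P F → DependsOn Q G → ColourSymmetric F → ColourSymmetric G →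
    (∀ {i} → P i → Q i → i ≡ v) →
    total n (λ c → F c * G c) * x ^ n ≡ total n F * total n G
  total-*-shared {suc m} {P} {Q} {F} {G} v P? F-dep G-dep F-sym G-sym meet = begin
    total (suc m) (λ c → F c * G c) * (x * x ^ m)
      ≡⟨ cong (_* (x * x ^ m)) (total-insertAt FG-ext v) ⟩
    sum tFG * (x * x ^ m)
      ≡⟨ ∑-slices tFG tF tG (x ^ m) (total-slice-invariant F-ext F-sym v) slice ⟩
    sum tF * sum tG
      ≡⟨ cong₂ _*_ (total-insertAt F-ext v) (total-insertAt G-ext v) ⟨
    total (suc m) F * total (suc m) G ∎
    where
    F-ext = depends⇒extensional F-dep
    G-ext = depends⇒extensional G-dep
    FG-ext : Extensional (λ c → F c * G c)
    FG-ext c≗d = cong₂ _*_ (F-ext c≗d) (G-ext c≗d)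
    tF tG tFG : Fin x → ℕ
    tF a = total m (λ c → F (insertAt c v a))
    tG a = total m (λ c → G (insertAt c v a))
    tFG a = total m (λ c → F (insertAt c v a) * G (insertAt c v a))
    slice : ∀ a → tFG a * x ^ m ≡ tF a * tG a
    slice a = total-*-disjoint (P? ∘ punchIn v) (insertAt-depends v a F-dep) (insertAt-depends v a G-dep)
                (λ Pi Qi → punchInᵢ≢i v _ (meet Pi Qi))

  length-filter-allMaps : ∀ {n} {P : Colouring n → Set} (P? : Decidable P) →
    (∀ {c d} → c ≗ d → P c → P d) → length (filter P? (allMaps n x)) ≡ total n (λ c → ⟦ P? c ⟧)
  length-filter-allMaps {zero} P? P-resp =
    trans (length-filter-[-] P? _) (⟦⟧-cong (P? _) (P? _) (P-resp (λ ())) (P-resp (λ ())))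
  length-filter-allMaps {suc n} P? P-resp = begin
    length (filter P? (concatMap (λ a → map (cons a) (allMaps n x)) (allFin x)))
      ≡⟨ length-filter-concatMap P? (λ a → map (cons a) (allMaps n x)) (λ a → a) ⟩
    ∑[ a < x ] length (filter P? (map (cons a) (allMaps n x)))
      ≡⟨ sum-cong-≗ (λ a → length-filter-map P? (cons a) (allMaps n x)) ⟩
    ∑[ a < x ] length (filter (P? ∘ cons a) (allMaps n x))
      ≡⟨ sum-cong-≗ (λ a → length-filter-allMaps (P? ∘ cons a) (P-resp ∘ cons-cong a)) ⟩
    ∑[ a < x ] total n (λ c → ⟦ P? (cons a c) ⟧) ∎

module Means (y : ℕ) where

  open Colourings (suc y) public

  x : ℕ
  x = suc y

  -- The average of F over all colourings is m / x ^ k.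
  record Mean {n} (F : Colouring n → ℕ) (m k : ℕ) : Set where
    constructor mkMean
    field total≡ : total n F * x ^ k ≡ x ^ n * m

  open Mean public

  mean-* : ∀ {n} {F G : Colouring n → ℕ} {m m′ k l} → Mean F m k → Mean G m′ l →
           total n (λ c → F c * G c) * x ^ n ≡ total n F * total n G →
           Mean (λ c → F c * G c) (m * m′) (k + l)
  mean-* {n} {F} {G} {m} {m′} {k} {l} (mkMean F-mean) (mkMean G-mean) independent =
    mkMean (*-cancelʳ-≡ _ _ (x ^ n) {{m^n≢0 x n}} (begin
      total n FG * x ^ (k + l) * x ^ n        ≡⟨ cong (λ z → total n FG * z * x ^ n) (^-distribˡ-+-* x k l) ⟩
      total n FG * (x ^ k * x ^ l) * x ^ n    ≡⟨ swap (total n FG) (x ^ k * x ^ l) (x ^ n) ⟩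
      total n FG * x ^ n * (x ^ k * x ^ l)    ≡⟨ cong (_* (x ^ k * x ^ l)) independent ⟩
      total n F * total n G * (x ^ k * x ^ l) ≡⟨ interchange (total n F) (total n G) (x ^ k) (x ^ l) ⟩
      total n F * x ^ k * (total n G * x ^ l) ≡⟨ cong₂ _*_ F-mean G-mean ⟩
      x ^ n * m * (x ^ n * m′)                ≡⟨ interchange (x ^ n) m (x ^ n) m′ ⟩
      x ^ n * x ^ n * (m * m′)                ≡⟨ swap (x ^ n) (x ^ n) (m * m′) ⟩
      x ^ n * (m * m′) * x ^ n                ∎))
    where
    FG = λ c → F c * G c
    swap : ∀ a b c → a * b * c ≡ a * c * b
    swap = solve-∀
    interchange : ∀ a b c d → a * b * (c * d) ≡ a * c * (b * d)
    interchange = solve-∀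

  ∑-distinct : ∀ (a : Fin x) → ∑[ b < x ] ⟦ ¬? (a ≟ b) ⟧ ≡ y
  ∑-distinct a = begin
    ∑[ b < x ] ⟦ ¬? (a ≟ b) ⟧                            ≡⟨ sum-remove {i = a} (λ b → ⟦ ¬? (a ≟ b) ⟧) ⟩
    ⟦ ¬? (a ≟ a) ⟧ + ∑[ j < y ] ⟦ ¬? (a ≟ punchIn a j) ⟧ ≡⟨ cong₂ _+_ (⟦⟧-no (¬? (a ≟ a)) (λ a≢a → a≢a refl))
                                                                    (sum-const 1 (λ j → ⟦⟧-yes (¬? (a ≟ punchIn a j)) (punchInᵢ≢i a j ∘ sym))) ⟩
    y * 1                                               ≡⟨ *-identityʳ y ⟩
    y                                                   ∎

  mean-distinct : ∀ {n} {u w : Fin n} → u ≢ w → Mean (λ c → ⟦ ¬? (c u ≟ c w) ⟧) y 1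
  mean-distinct {n} {u} {w} u≢w = mkMean (*-cancelʳ-≡ _ _ x (begin
    total n D * (x * 1) * x   ≡⟨ regroup (total n D) x ⟩
    total n D * x ^ 2         ≡⟨ total-emb D₂-ext pair pair-injective ⟩
    x ^ n * total 2 D₂        ≡⟨ cong (x ^ n *_) (sum-const {f = λ a → total 1 (D₂ ∘ cons a)} y ∑-distinct) ⟩
    x ^ n * (x * y)           ≡⟨ cong (x ^ n *_) (*-comm x y) ⟩
    x ^ n * (y * x)           ≡⟨ *-assoc (x ^ n) y x ⟨
    x ^ n * y * x             ∎))
    where
    regroup : ∀ a b → a * (b * 1) * b ≡ a * (b * (b * 1))
    regroup = solve-∀
    D : Colouring n → ℕ
    D c = ⟦ ¬? (c u ≟ c w) ⟧
    D₂ : Colouring 2 → ℕ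
    D₂ c = ⟦ ¬? (c zero ≟ c (suc zero)) ⟧
    D₂-ext : Extensional D₂
    D₂-ext c≗d = cong₂ (λ a b → ⟦ ¬? (a ≟ b) ⟧) (c≗d zero) (c≗d (suc zero))
    pair : Fin 2 → Fin n
    pair zero       = u
    pair (suc zero) = w
    pair-injective : Injective _≡_ _≡_ pair
    pair-injective {zero}     {zero}     _   = refl
    pair-injective {zero}     {suc zero} u≡w = ⊥-elim (u≢w u≡w)
    pair-injective {suc zero} {zero}     w≡u = ⊥-elim (u≢w (sym w≡u))
    pair-injective {suc zero} {suc zero} _   = refl

  proper-cong : ∀ {m} (g : Graph m) {c d : Colouring m} → c ≗ d → Proper g x c → Proper g x d
  proper-cong g c≗d c-proper u v uv cu≡cv = c-proper u v uv (trans (c≗d u) (trans cu≡cv (sym (c≗d v))))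

  proper-extensional : ∀ {m} (g : Graph m) → Extensional (λ c → ⟦ proper? g x c ⟧)
  proper-extensional g c≗d = ⟦⟧-cong (proper? g x _) (proper? g x _) (proper-cong g c≗d) (proper-cong g (sym ∘ c≗d))

  Q≡total : ∀ {m} (g : Graph m) → Q g y ≡ total m (λ c → ⟦ proper? g x c ⟧)
  Q≡total g = length-filter-allMaps (proper? g x) (proper-cong g)

  proper-symmetric : ∀ {m} (g : Graph m) → ColourSymmetric (λ c → ⟦ proper? g x c ⟧)
  proper-symmetric g π c = ⟦⟧-cong (proper? g x _) (proper? g x c)
    (λ πc-proper u v uv cu≡cv → πc-proper u v uv (cong (π ⟨$⟩ʳ_) cu≡cv))
    (λ c-proper u v uv πcu≡πcv → c-proper u v uv (permutation-injective π πcu≡πcv))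

  distinct-symmetric : ∀ {m} (u w : Fin m) → ColourSymmetric (λ c → ⟦ ¬? (c u ≟ c w) ⟧)
  distinct-symmetric u w π c = ⟦⟧-cong (¬? (_ ≟ _)) (¬? (c u ≟ c w))
    (λ πcu≢πcw cu≡cw → πcu≢πcw (cong (π ⟨$⟩ʳ_) cu≡cw))
    (λ cu≢cw πcu≡πcw → cu≢cw (permutation-injective π πcu≡πcw))

-- Clusters of pieces and edges

vertices : ∀ {n} {G : Graph n} → Subgraph G → Subset n
vertices H = image (emb H)

module Clusters {n : ℕ} (G : Graph n) (y : ℕ) where

  open Means y

  -- `parts` counts the pieces glued in; size-law says that pieces and edges are glued
  -- along a tree, each new one sharing exactly one vertex with what is already there.
  record Cluster : Set where
    field
      covered   : Subset n
      event     : Colouring n → ℕ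
      parts     : ℕ
      order     : ℕ
      mass      : ℕ
      depends   : DependsOn (_∈ covered) event
      symmetric : ColourSymmetric event
      mean      : Mean event mass order
      proper⇒1  : ∀ c → Proper G x c → event c ≡ 1
      size-law  : ∣ covered ∣ + parts ≡ suc order

  open Cluster public

  pieceCluster : Subgraph G → Cluster
  pieceCluster H = record
    { covered   = vertices H
    ; event     = F
    ; parts     = 1
    ; order     = size H
    ; mass      = Q (graph H) y
    ; depends   = λ agree → proper-extensional (graph H) (λ t → agree (∈-image⁺ (emb H) t))
    ; symmetric = λ π c → proper-symmetric (graph H) π (c ∘ emb H)
    ; mean      = mkMean (trans (total-emb (proper-extensional (graph H)) (emb H) (λ {s} {t} → emb-inj H s t))
                        (cong (x ^ n *_) (sym (Q≡total (graph H)))))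
    ; proper⇒1  = λ c c-proper → ⟦⟧-yes (proper? (graph H) x (c ∘ emb H))
                                   (λ s t st → c-proper (emb H s) (emb H t) (emb-adj H s t st))
    ; size-law  = trans (cong (_+ 1) (∣image∣≡m (emb H) (λ {s} {t} → emb-inj H s t))) (+-comm (size H) 1)
    }
    where
    F : Colouring n → ℕ
    F c = ⟦ proper? (graph H) x (c ∘ emb H) ⟧

  edge⇒≢ : ∀ {u w} → T (adj G u w) → u ≢ w
  edge⇒≢ {u} uw refl = subst T (adj-irrefl G u) uw

  edgeCluster : ∀ {u w} → T (adj G u w) → Cluster
  edgeCluster {u} {w} uw = record
    { covered   = ⁅ u ⁆ ∪ ⁅ w ⁆
    ; event     = λ c → ⟦ ¬? (c u ≟ c w) ⟧
    ; parts     = 0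
    ; order     = 1
    ; mass      = y
    ; depends   = λ agree → cong₂ (λ a b → ⟦ ¬? (a ≟ b) ⟧) (agree (x∈p∪q⁺ (inj₁ (x∈⁅x⁆ u))))
                                                         (agree (x∈p∪q⁺ (inj₂ (x∈⁅x⁆ w))))
    ; symmetric = distinct-symmetric u w
    ; mean      = mean-distinct (edge⇒≢ uw)
    ; proper⇒1  = λ c c-proper → ⟦⟧-yes (¬? (c u ≟ c w)) (c-proper u w uw)
    ; size-law  = begin
        ∣ ⁅ u ⁆ ∪ ⁅ w ⁆ ∣ + 0 ≡⟨ +-identityʳ _ ⟩
        ∣ ⁅ u ⁆ ∪ ⁅ w ⁆ ∣     ≡⟨ ∣⁅x⁆∪p∣≡1+∣p∣ (x≢y⇒x∉⁅y⁆ (edge⇒≢ uw)) ⟩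
        suc ∣ ⁅ w ⁆ ∣         ≡⟨ cong suc (∣⁅x⁆∣≡1 w) ⟩
        2                     ∎
    }

  glue : (C D : Cluster) (v : Fin n) → covered C ∩ covered D ≡ ⁅ v ⁆ → Cluster
  glue C D v meet = record
    { covered   = covered C ∪ covered D
    ; event     = λ c → event C c * event D c
    ; parts     = parts C + parts D
    ; order     = order C + order D
    ; mass      = mass C * mass D
    ; depends   = λ agree → cong₂ _*_ (depends C (agree ∘ x∈p∪q⁺ ∘ inj₁)) (depends D (agree ∘ x∈p∪q⁺ ∘ inj₂))
    ; symmetric = λ π c → cong₂ _*_ (symmetric C π c) (symmetric D π c)
    ; mean      = mean-* (mean C) (mean D)
                    (total-*-shared v (_∈? covered C) (depends C) (depends D) (symmetric C) (symmetric D)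
                      (λ i∈C i∈D → x∈⁅y⁆⇒x≡y v (subst (_ ∈_) meet (x∈p∩q⁺ (i∈C , i∈D)))))
    ; proper⇒1  = λ c c-proper → cong₂ _*_ (proper⇒1 C c c-proper) (proper⇒1 D c c-proper)
    ; size-law  = suc-injective (begin
        suc (∣ covered C ∪ covered D ∣ + (parts C + parts D)) ≡⟨ regroup ∣ covered C ∪ covered D ∣ (parts C) (parts D) ⟩
        ∣ covered C ∪ covered D ∣ + 1 + (parts C + parts D)   ≡⟨ cong (_+ (parts C + parts D)) (∣p∪q∣+1≡∣p∣+∣q∣ meet) ⟩
        ∣ covered C ∣ + ∣ covered D ∣ + (parts C + parts D)   ≡⟨ interchange ∣ covered C ∣ ∣ covered D ∣ (parts C) (parts D) ⟩
        (∣ covered C ∣ + parts C) + (∣ covered D ∣ + parts D) ≡⟨ cong₂ _+_ (size-law C) (size-law D) ⟩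
        suc (order C) + suc (order D)                         ≡⟨ cong suc (+-suc (order C) (order D)) ⟩
        suc (suc (order C + order D))                         ∎)
    }
    where
    regroup : ∀ a b c → suc (a + (b + c)) ≡ a + 1 + (b + c)
    regroup = solve-∀
    interchange : ∀ a b c d → a + b + (c + d) ≡ (a + c) + (b + d)
    interchange = solve-∀

boundary : ∀ {n} (G : Graph n) (A : Subset n) {a b} → Reach G a b → a ∈ A → b ∉ A →
           ∃ λ u → ∃ λ w → u ∈ A × w ∉ A × T (adj G u w)
boundary G A here                     a∈A a∉A = ⊥-elim (a∉A a∈A)
boundary G A (step {u} {v} uv v⇝b) u∈A b∉A with v ∈? A
... | yes v∈A = boundary G A v⇝b v∈A b∉A
... | no  v∉A = u , v , u∈A , v∉A , uv

mean-bound : ∀ {y q t n k a e p} → q ≤ t → t * suc y ^ (a + e) ≡ suc y ^ n * (p * y ^ e) →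
             n + k ≡ a + e → q * y ^ a * suc y ^ k ≤ y ^ n * y ^ k * p
mean-bound {y} {q} {t} {n} {k} {a} {e} {p} q≤t mean n+k≡a+e =
  *-cancelʳ-≤ _ _ (x ^ (a + e)) {{m^n≢0 x (a + e)}} (≤-trans
    (*-monoˡ-≤ (x ^ (a + e)) (*-monoˡ-≤ (x ^ k) (*-monoˡ-≤ (y ^ a) q≤t)))
    (≤-reflexive (begin
      t * y ^ a * x ^ k * x ^ (a + e)              ≡⟨ regroup t (y ^ a) (x ^ k) (x ^ (a + e)) ⟩
      t * x ^ (a + e) * (y ^ a * x ^ k)            ≡⟨ cong (_* (y ^ a * x ^ k)) mean ⟩
      x ^ n * (p * y ^ e) * (y ^ a * x ^ k)        ≡⟨ regroup′ (x ^ n) p (y ^ e) (y ^ a) (x ^ k) ⟩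
      p * (y ^ a * y ^ e) * (x ^ n * x ^ k)        ≡⟨ cong₂ (λ s t → p * s * t) (^-distribˡ-+-* y a e) (^-distribˡ-+-* x n k) ⟨
      p * y ^ (a + e) * x ^ (n + k)                ≡⟨ cong₂ (λ s t → p * y ^ s * x ^ t) (sym n+k≡a+e) n+k≡a+e ⟩
      p * y ^ (n + k) * x ^ (a + e)                ≡⟨ cong (λ s → p * s * x ^ (a + e)) (^-distribˡ-+-* y n k) ⟩
      p * (y ^ n * y ^ k) * x ^ (a + e)            ≡⟨ cong (_* x ^ (a + e)) (*-comm p (y ^ n * y ^ k)) ⟩
      y ^ n * y ^ k * p * x ^ (a + e)              ∎)))
  where
  x = suc y
  regroup : ∀ a b c d → a * b * c * d ≡ a * d * (b * c)
  regroup = solve-∀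
  regroup′ : ∀ a b c d f → a * (b * c) * (d * f) ≡ b * (d * c) * (a * f)
  regroup′ = solve-∀

module Growth {n : ℕ} (G : Graph n) {r : ℕ} (H : Fin r → Subgraph G) (y : ℕ) where

  open Means y
  open Clusters G y

  sizeOf weightOf : Subset r → ℕ
  sizeOf   K = Sum.fold K (λ i → size (H i))
  weightOf K = Product.fold K (λ i → Q (graph (H i)) y)

  record Stage : Set where
    field
      cluster : Cluster
      chosen  : Subset r
      crossed : ℕ
      parts≡  : parts cluster ≡ ∣ chosen ∣
      order≡  : order cluster ≡ sizeOf chosen + crossed
      mass≡   : mass cluster ≡ weightOf chosen * y ^ crossed

  open Stage public

  start : Fin r → Stage
  start i = record
    { cluster = pieceCluster (H i)
    ; chosen  = ⁅ i ⁆
    ; crossed = 0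
    ; parts≡  = sym (∣⁅x⁆∣≡1 i)
    ; order≡  = sym (trans (+-identityʳ _) (Sum.fold-⁅⁆ i _))
    ; mass≡   = sym (trans (*-identityʳ _) (Product.fold-⁅⁆ i _))
    }

  absorb : (s : Stage) {i : Fin r} {v : Fin n} → i ∉ chosen s →
           covered (cluster s) ∩ vertices (H i) ≡ ⁅ v ⁆ → Stage
  absorb s {i} {v} i∉K meet = record
    { cluster = glue (cluster s) (pieceCluster (H i)) v meet
    ; chosen  = ⁅ i ⁆ ∪ chosen s
    ; crossed = crossed s
    ; parts≡  = begin
        parts (cluster s) + 1   ≡⟨ +-comm _ 1 ⟩
        suc (parts (cluster s)) ≡⟨ cong suc (parts≡ s) ⟩
        suc ∣ chosen s ∣        ≡⟨ ∣⁅x⁆∪p∣≡1+∣p∣ i∉K ⟨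
        ∣ ⁅ i ⁆ ∪ chosen s ∣    ∎
    ; order≡  = begin
        order (cluster s) + h                 ≡⟨ cong (_+ h) (order≡ s) ⟩
        sizeOf (chosen s) + crossed s + h     ≡⟨ rotate (sizeOf (chosen s)) (crossed s) h ⟩
        h + sizeOf (chosen s) + crossed s     ≡⟨ cong (_+ crossed s) (Sum.fold-⁅⁆∪ _ i∉K) ⟨
        sizeOf (⁅ i ⁆ ∪ chosen s) + crossed s ∎
    ; mass≡   = begin
        mass (cluster s) * q                          ≡⟨ cong (_* q) (mass≡ s) ⟩
        weightOf (chosen s) * y ^ crossed s * q       ≡⟨ rotate′ (weightOf (chosen s)) (y ^ crossed s) q ⟩
        q * weightOf (chosen s) * y ^ crossed s       ≡⟨ cong (_* y ^ crossed s) (Product.fold-⁅⁆∪ _ i∉K) ⟨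
        weightOf (⁅ i ⁆ ∪ chosen s) * y ^ crossed s   ∎
    }
    where
    h = size (H i)
    q = Q (graph (H i)) y
    rotate : ∀ a b c → a + b + c ≡ c + a + b
    rotate = solve-∀
    rotate′ : ∀ a b c → a * b * c ≡ c * a * b
    rotate′ = solve-∀

  cross : (s : Stage) {u w : Fin n} (uw : T (adj G u w)) →
           covered (cluster s) ∩ (⁅ u ⁆ ∪ ⁅ w ⁆) ≡ ⁅ u ⁆ → Stage
  cross s {u} uw meet = record
    { cluster = glue (cluster s) (edgeCluster uw) u meet
    ; chosen  = chosen s
    ; crossed = suc (crossed s)
    ; parts≡  = trans (+-identityʳ _) (parts≡ s)
    ; order≡  = trans (cong (_+ 1) (order≡ s)) (shift (sizeOf (chosen s)) (crossed s))
    ; mass≡   = trans (cong (_* y) (mass≡ s)) (shift′ (weightOf (chosen s)) (y ^ crossed s) y)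
    }
    where
    shift : ∀ a b → a + b + 1 ≡ a + suc b
    shift = solve-∀
    shift′ : ∀ a c b → a * c * b ≡ a * (b * c)
    shift′ = solve-∀

  Covers : Subset n → Subset r → Set
  Covers A K = ∀ {j} → j ∈ K → vertices (H j) ⊆ A

  Saturated : Subset n → Subset r → Set
  Saturated A K = ∀ {v j} → v ∈ A → v ∈ vertices (H j) → ∃ λ k → k ∈ K × v ∈ vertices (H k)

  record WellFormed (s : Stage) : Set where
    field
      covers    : Covers (covered (cluster s)) (chosen s)
      saturated : Saturated (covered (cluster s)) (chosen s)
      inhabited : Nonempty (covered (cluster s))

  open WellFormed public

  covers-mono : ∀ {A A′ K} → A ⊆ A′ → Covers A K → Covers A′ K
  covers-mono A⊆A′ cov j∈K = A⊆A′ ∘ cov j∈K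

  covers-⁅⁆∪ : ∀ {A K i} → vertices (H i) ⊆ A → Covers A K → Covers A (⁅ i ⁆ ∪ K)
  covers-⁅⁆∪ {K = K} {i} Vi⊆A cov j∈ with x∈p∪q⁻ ⁅ i ⁆ K j∈
  ... | inj₁ j∈⁅i⁆ rewrite x∈⁅y⁆⇒x≡y i j∈⁅i⁆ = Vi⊆A
  ... | inj₂ j∈K = cov j∈K

  saturated-⊆ : ∀ {A B K} → B ⊆ A → Saturated A K → Saturated B K
  saturated-⊆ B⊆A sat v∈B = sat (B⊆A v∈B)

  saturated-∪ : ∀ {A B K} → Saturated A K → Saturated B K → Saturated (A ∪ B) K
  saturated-∪ {A} {B} satA satB v∈ with x∈p∪q⁻ A B v∈
  ... | inj₁ v∈A = satA v∈A
  ... | inj₂ v∈B = satB v∈B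

  saturated-mono : ∀ {A K K′} → K ⊆ K′ → Saturated A K → Saturated A K′
  saturated-mono K⊆K′ sat v∈A v∈Vj with sat v∈A v∈Vj
  ... | k , k∈K , v∈Vk = k , K⊆K′ k∈K , v∈Vk

  saturated-vertices : ∀ {i K} → i ∈ K → Saturated (vertices (H i)) K
  saturated-vertices {i} i∈K v∈Vi _ = i , i∈K , v∈Vi

  saturated-free : ∀ {w K} → (∀ j → w ∉ vertices (H j)) → Saturated ⁅ w ⁆ K
  saturated-free {w} free v∈⁅w⁆ v∈Vj rewrite x∈⁅y⁆⇒x≡y w v∈⁅w⁆ = ⊥-elim (free _ v∈Vj)

  Successor : Stage → Set
  Successor s = Σ[ s′ ∈ Stage ] WellFormed s′ × order (cluster s) < order (cluster s′)

  module Steps (connected : Connected G) (nonempty : ∀ i → 1 ≤ size (H i)) (at-most-one : AtMostOneShared H) where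

    shared-singleton : (s : Stage) → WellFormed s → ∀ {i v} → i ∉ chosen s →
                       v ∈ covered (cluster s) → v ∈ vertices (H i) →
                       covered (cluster s) ∩ vertices (H i) ≡ ⁅ v ⁆
    shared-singleton s wf {i} i∉K v∈A v∈Vi = ∩≡⁅⁆ v∈A v∈Vi (λ w∈A w∈Vi → only w∈A w∈Vi v∈A v∈Vi)
      where
      in-others : ∀ {w} → w ∈ covered (cluster s) → w ∈ vertices (H i) → InOthers H i w
      in-others w∈A w∈Vi with saturated wf w∈A w∈Vi
      ... | k , k∈K , w∈Vk with ∈-image⁻ (emb (H k)) w∈Vk
      ...   | t , et≡w = k , (λ { refl → i∉K k∈K }) , t , et≡w
      only : ∀ {w v} → w ∈ covered (cluster s) → w ∈ vertices (H i) →
                       v ∈ covered (cluster s) → v ∈ vertices (H i) → w ≡ v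
      only w∈A w∈Vi v∈A v∈Vi with ∈-image⁻ (emb (H i)) w∈Vi | ∈-image⁻ (emb (H i)) v∈Vi
      ... | s , refl | t , refl = cong (emb (H i)) (at-most-one i s t (in-others w∈A w∈Vi) (in-others v∈A v∈Vi))

    absorb-step : (s : Stage) → WellFormed s → ∀ {i v} → i ∉ chosen s →
                  v ∈ covered (cluster s) → v ∈ vertices (H i) → Successor s
    absorb-step s wf {i} {v} i∉K v∈A v∈Vi = absorb s i∉K (shared-singleton s wf i∉K v∈A v∈Vi) , record
      { covers    = covers-⁅⁆∪ (q⊆p∪q _ _) (covers-mono (p⊆p∪q _) (covers wf))
      ; saturated = saturated-∪ (saturated-mono (q⊆p∪q ⁅ i ⁆ _) (saturated wf))
                                (saturated-vertices (x∈p∪q⁺ (inj₁ (x∈⁅x⁆ i))))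
      ; inhabited = v , x∈p∪q⁺ (inj₁ v∈A)
      } , m<m+n _ (nonempty i)

    cross-step : (s : Stage) → WellFormed s → ∀ {u w} (uw : T (adj G u w)) →
                  u ∈ covered (cluster s) → w ∉ covered (cluster s) → (∀ j → w ∉ vertices (H j)) → Successor s
    cross-step s wf {u} uw u∈A w∉A free = cross s uw (∩⁅x⁆∪⁅y⁆≡⁅x⁆ u∈A w∉A) , record
      { covers    = covers-mono (p⊆p∪q _) (covers wf)
      ; saturated = saturated-∪ (saturated wf)
                      (saturated-∪ (saturated-⊆ (x∈p⇒⁅x⁆⊆p u∈A) (saturated wf)) (saturated-free free))
      ; inhabited = u , x∈p∪q⁺ (inj₁ u∈A)
      } , m<m+n _ z<s

    cross-absorb-step : (s : Stage) → WellFormed s → ∀ {u w i} (uw : T (adj G u w)) →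
      u ∈ covered (cluster s) → w ∉ covered (cluster s) → w ∈ vertices (H i) →
      (∀ {v} → v ∈ covered (cluster s) → v ∉ vertices (H i)) → Successor s
    cross-absorb-step s wf {u} {w} {i} uw u∈A w∉A w∈Vi apart =
      absorb (cross s uw (∩⁅x⁆∪⁅y⁆≡⁅x⁆ u∈A w∉A)) i∉K meet , record
      { covers    = covers-⁅⁆∪ (q⊆p∪q _ _) (covers-mono (p⊆p∪q _ ∘ p⊆p∪q _) (covers wf))
      ; saturated = saturated-∪
          (saturated-∪ (saturated-mono (q⊆p∪q ⁅ i ⁆ _) (saturated wf))
            (saturated-∪ (saturated-⊆ (x∈p⇒⁅x⁆⊆p u∈A) (saturated-mono (q⊆p∪q ⁅ i ⁆ _) (saturated wf)))
                         (saturated-⊆ (x∈p⇒⁅x⁆⊆p w∈Vi) (saturated-vertices i∈K′))))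
          (saturated-vertices i∈K′)
      ; inhabited = u , x∈p∪q⁺ (inj₁ (x∈p∪q⁺ (inj₁ u∈A)))
      } , ≤-trans (m<m+n _ z<s) (m≤m+n _ (size (H i)))
      where
      i∉K : i ∉ chosen s
      i∉K i∈K = w∉A (covers wf i∈K w∈Vi)
      i∈K′ : i ∈ ⁅ i ⁆ ∪ chosen s
      i∈K′ = x∈p∪q⁺ (inj₁ (x∈⁅x⁆ i))
      meet : (covered (cluster s) ∪ (⁅ u ⁆ ∪ ⁅ w ⁆)) ∩ vertices (H i) ≡ ⁅ w ⁆
      meet = ∩≡⁅⁆ (x∈p∪q⁺ (inj₂ (x∈p∪q⁺ (inj₂ (x∈⁅x⁆ w))))) w∈Vi λ z∈ z∈Vi →
        case x∈p∪q⁻ (covered (cluster s)) _ z∈ of λ where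
          (inj₁ z∈A)  → ⊥-elim (apart z∈A z∈Vi)
          (inj₂ z∈uw) → case ∈-pair⁻ z∈uw of λ where
            (inj₁ refl) → ⊥-elim (apart u∈A z∈Vi)
            (inj₂ z≡w)  → z≡w

    Finished : Stage → Set
    Finished s = (∀ v → v ∈ covered (cluster s)) × (∀ i → i ∈ chosen s)

    some-vertex : ∀ i → Fin n
    some-vertex i = emb (H i) (fromℕ< (nonempty i))

    advance : (s : Stage) → WellFormed s → Finished s ⊎ Successor s
    advance s wf with any? (λ i → ¬? (i ∈? chosen s) ×-dec nonempty? (covered (cluster s) ∩ vertices (H i)))
    ... | yes (i , i∉K , v , v∈) = let v∈A , v∈Vi = x∈p∩q⁻ _ _ v∈ in inj₂ (absorb-step s wf i∉K v∈A v∈Vi)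
    ... | no untouched with any? (λ v → ¬? (v ∈? covered (cluster s)))
    ...   | no full = inj₁ (all-covered , all-chosen)
      where
      all-covered : ∀ v → v ∈ covered (cluster s)
      all-covered v = decidable-stable (v ∈? _) (λ v∉A → full (v , v∉A))
      all-chosen : ∀ i → i ∈ chosen s
      all-chosen i = decidable-stable (i ∈? _) λ i∉K →
        untouched (i , i∉K , some-vertex i , x∈p∩q⁺ (all-covered _ , ∈-image⁺ (emb (H i)) _))
    ...   | yes (w₀ , w₀∉A)
      with boundary G (covered (cluster s)) (connected (proj₁ (inhabited wf)) w₀) (proj₂ (inhabited wf)) w₀∉A
    ...     | u , w , u∈A , w∉A , uw with any? (λ i → w ∈? vertices (H i))
    ...       | no free = inj₂ (cross-step s wf uw u∈A w∉A (λ j w∈Vj → free (j , w∈Vj)))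
    ...       | yes (i , w∈Vi) = inj₂ (cross-absorb-step s wf uw u∈A w∉A w∈Vi apart)
      where
      apart : ∀ {v} → v ∈ covered (cluster s) → v ∉ vertices (H i)
      apart v∈A v∈Vi = untouched (i , (λ i∈K → w∉A (covers wf i∈K w∈Vi)) , _ , x∈p∩q⁺ (v∈A , v∈Vi))

    order-bound : (s : Stage) → order (cluster s) < n + r
    order-bound s = subst (_≤ n + r) (trans (cong (∣ covered (cluster s) ∣ +_) (sym (parts≡ s))) (size-law (cluster s)))
                          (+-mono-≤ (∣p∣≤n (covered (cluster s))) (∣p∣≤n (chosen s)))

    grow : (s : Stage) → WellFormed s → Acc _<_ (n + r ∸ order (cluster s)) → Σ Stage Finished
    grow s wf (acc more) with advance s wf
    ... | inj₁ done              = s , done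
    ... | inj₂ (s′ , wf′ , s<s′) = grow s′ wf′ (more (∸-monoʳ-< s<s′ (<⇒≤ (order-bound s′))))

    finished-bound : (s : Stage) → Finished s → 1 ≤ r →
      Q G y * y ^ sumFin r (λ i → size (H i)) * x ^ (r ∸ 1)
        ≤ y ^ n * y ^ (r ∸ 1) * prodFin r (λ i → Q (graph (H i)) y)
    finished-bound s (all-covered , all-chosen) 1≤r =
      mean-bound {y} {n = n} {k = r ∸ 1} {a = Σh} {e = crossed s} {p = Πq}
                 (subst (_≤ total n (event C)) (sym (Q≡total G))
                        (total-mono-≤ (λ c → ⟦⟧-≤ (proper? G x c) (proper⇒1 C c))))
                 (subst₂ (λ o m → total n (event C) * x ^ o ≡ x ^ n * m) order≡Σ mass≡Π (total≡ (mean C)))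
                 counting
      where
      C = cluster s
      Σh = sumFin r (λ i → size (H i))
      Πq = prodFin r (λ i → Q (graph (H i)) y)
      K≡Full : chosen s ≡ Full
      K≡Full = ∀∈⇒≡Full all-chosen
      order≡Σ : order C ≡ Σh + crossed s
      order≡Σ = trans (order≡ s) (cong (_+ crossed s) (trans (cong sizeOf K≡Full) (sym (sumFin≡fold r _))))
      mass≡Π : mass C ≡ Πq * y ^ crossed s
      mass≡Π = trans (mass≡ s) (cong (_* y ^ crossed s) (trans (cong weightOf K≡Full) (sym (prodFin≡fold r _))))
      counting : n + (r ∸ 1) ≡ Σh + crossed s
      counting = begin
        n + (r ∸ 1)                                   ≡⟨ +-∸-assoc n 1≤r ⟨
        n + r ∸ 1                                     ≡⟨ cong₂ (λ a b → a + b ∸ 1) (∣⊤∣≡n n) (∣⊤∣≡n r) ⟨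
        ∣ Full {n} ∣ + ∣ Full {r} ∣ ∸ 1               ≡⟨ cong₂ (λ A K → ∣ A ∣ + ∣ K ∣ ∸ 1) (∀∈⇒≡Full all-covered) K≡Full ⟨
        ∣ covered C ∣ + ∣ chosen s ∣ ∸ 1              ≡⟨ cong (λ k → ∣ covered C ∣ + k ∸ 1) (parts≡ s) ⟨
        ∣ covered C ∣ + parts C ∸ 1                   ≡⟨ cong (_∸ 1) (size-law C) ⟩
        order C                                       ≡⟨ order≡Σ ⟩
        Σh + crossed s                                ∎

    start-wellFormed : ∀ i → WellFormed (start i)
    start-wellFormed i = record
      { covers    = λ j∈⁅i⁆ → subst (λ j → vertices (H j) ⊆ vertices (H i)) (sym (x∈⁅y⁆⇒x≡y i j∈⁅i⁆)) (λ v∈ → v∈)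
      ; saturated = saturated-vertices (x∈⁅x⁆ i)
      ; inhabited = some-vertex i , ∈-image⁺ (emb (H i)) _
      }

lemma2p2 : ∀ {n : ℕ} (G : Graph n) → Connected G →
    (r : ℕ) → 1 ≤ r → (H : Fin r → Subgraph G) →
    (∀ i → 1 ≤ size (H i)) → AtMostOneShared H →
    (y : ℕ) → 1 ≤ y →
    Q G y * y ^ sumFin r (λ i → size (H i)) * suc y ^ (r ∸ 1)
      ≤ y ^ n * y ^ (r ∸ 1) * prodFin r (λ i → Q (graph (H i)) y)
lemma2p2 G connected r 1≤r H nonempty at-most-one y _ =
  let s , finished = grow (start i₀) (start-wellFormed i₀) (<-wellFounded _)
  in  finished-bound s finished 1≤r
  where
  open Growth G H y
  open Steps connected nonempty at-most-one
  i₀ = fromℕ< 1≤r
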